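{- Let $n \ge 2$ and let $R_{4n+3}$ be the graph with vertex set $\{0,1,\ldots,4n+2\}$ whose edges are $i\,(i+1)$ for $0 \le i \le 4n+1$ together with the three additional edges $0\,4$, $5\,8$ and $1\,7$. Then $\gamma_g(R_{4n+3}) \le 2n+2$.
   Context: The domination game on a graph $G$ is played by Dominator and Staller, who alternately select vertices of $G$; each selected vertex must dominate (i.e., be equal or adjacent to) at least one vertex not dominated by the previously selected vertices. The game ends when no such move is possible. Dominator wants to minimize the number of moves, Staller to maximize it. $\gamma_g(G)$ is the number of moves when both play optimally and Dominator makes the first move. -}

module Defs where

open import Data.Nat using (ℕ; zero; suc; _+_; _*_)
open import Data.Fin using (Fin; toℕ)
open import Data.List using (List; []; _∷_)
open import Data.List.Relation.Unary.Any using (Any)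
open import Data.Product using (Σ; _×_; _,_)
open import Data.Sum using (_⊎_)
open import Relation.Nullary using (¬_)
open import Relation.Binary.PropositionalEquality using (_≡_)

record Graph (m : ℕ) : Set₁ where
  field
    Adj : Fin m → Fin m → Set

module Game {m : ℕ} (G : Graph m) where
  open Graph G

  Dominates : Fin m → Fin m → Set
  Dominates v u = (u ≡ v) ⊎ Adj v u

  Dominated : List (Fin m) → Fin m → Set
  Dominated played u = Any (λ v → Dominates v u) played

  Legal : List (Fin m) → Fin m → Set
  Legal played v = Σ (Fin m) (λ u → Dominates v u × ¬ Dominated played u)

  Ended : List (Fin m) → Set
  Ended played = (v : Fin m) → ¬ Legal played v

  -- DomForces k ps : Dominator is to move in position ps (selected vertices so far)
  --   and can guarantee (against every Staller strategy) that the game ends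
  --   within at most k further moves.
  data DomForces : ℕ → List (Fin m) → Set
  data StaForces : ℕ → List (Fin m) → Set

  data DomForces where
    d-end  : ∀ {k ps} → Ended ps → DomForces k ps
    d-move : ∀ {k ps} (v : Fin m) → Legal ps v → StaForces k (v ∷ ps) → DomForces (suc k) ps

  data StaForces where
    s-end  : ∀ {k ps} → Ended ps → StaForces k ps
    s-move : ∀ {k ps} → ((v : Fin m) → Legal ps v → DomForces k (v ∷ ps)) → StaForces (suc k) ps

-- γ_g(G) ≤ k : with optimal play and Dominator moving first, the game lasts at most k moves,
-- i.e. Dominator has a strategy that ends the game within k moves whatever Staller does.
GameDomNumberAtMost : {m : ℕ} → Graph m → ℕ → Set
GameDomNumberAtMost G k = Game.DomForces G k []

REdge : ℕ → ℕ → Set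
REdge a b = (suc a ≡ b) ⊎ ((a ≡ 0 × b ≡ 4) ⊎ ((a ≡ 5 × b ≡ 8) ⊎ (a ≡ 1 × b ≡ 7)))

R : (n : ℕ) → Graph (4 * n + 3)
R n = record { Adj = λ i j → REdge (toℕ i) (toℕ j) ⊎ REdge (toℕ j) (toℕ i) }

module Submission where

-- Dominator opens with vertex 1 and afterwards plays so that a
-- potential W (a number attached to every position) drops by at least 2 over each
-- Staller move together with Dominator's answer, while W = 0 means the game is over.
--
-- The potential is built from blocks: lists of vertices covering the graph.  A block
-- contributes min(2, number of its still undominated vertices), and it must admit a
-- "finisher" (once one of its vertices is dominated, a single vertex dominates all
-- the rest of it) and a "reducer" (a vertex lowering the contribution of an untouched
-- block).  If Staller's move dominates a new vertex of block B, either B's weight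
-- drops and Dominator lowers any positive block by 1, or B had at least 2 undominated
-- vertices left and Dominator finishes B, removing its full weight 2.
--
-- For R_{4n+3} (n = 2 + p) the blocks are {0,1,2,7} and {3,4,5} (stars around 1 and
-- 4), {6,8,9}, the p paths {10+4i,…,13+4i}, and the single vertex 4n+2.  After the
-- opening move 1 the potential is at most 0 + 2 + 2 + 1 + 2p = 2n + 1, so the game
-- lasts at most 2n + 2 moves.

open import Defs
open import Data.Nat using (ℕ; zero; suc; _≤_; _<_; _*_; _+_; _≟_; _<?_; _≤?_; z≤n; s≤s; s≤s⁻¹)
open import Data.Nat.Properties
open import Data.Nat.DivMod using (_/_; _%_; m≡m%n+[m/n]*n; m%n<n; m<n*o⇒m/o<n)
open import Data.Nat.ListAction using (sum)
open import Algebra.Properties.CommutativeSemigroup +-commutativeSemigroup using (x∙yz≈y∙xz)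
open import Data.Fin using (Fin; toℕ; fromℕ<)
open import Data.Fin.Properties using (toℕ<n; toℕ-fromℕ<; toℕ-injective)
open import Data.List using (List; []; _∷_; length; map; tabulate)
open import Data.List.Properties using (length-tabulate)
open import Data.List.Relation.Unary.All using (All; []; _∷_)
import Data.List.Relation.Unary.All as All
open import Data.List.Relation.Unary.Any using (Any; here; there; any?)
import Data.List.Relation.Unary.Any as Any
open import Data.List.Relation.Unary.Any.Properties using (Any-⊎⁻; map⁺; map⁻)
open import Data.List.Membership.Propositional using (_∈_; find)
open import Data.List.Membership.Propositional.Properties using (∈-tabulate⁺)
open import Data.Product using (Σ; _×_; _,_)
open import Data.Sum using (_⊎_; inj₁; inj₂; [_,_]′)
open import Relation.Nullary using (¬_; Dec; yes; no; contradiction)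
open import Relation.Nullary.Decidable using (_×-dec_; _⊎-dec_; True; toWitness)
open import Relation.Binary.PropositionalEquality

module PotentialStrategy
  {m : ℕ} (G : Graph m) (W : List (Fin m) → ℕ)
  (exhausted : ∀ ps → W ps ≡ 0 → Game.Ended G ps)
  (round : ∀ ps v → Game.Legal G ps v → W (v ∷ ps) ≢ 0 →
           Σ (Fin m) λ w → Game.Legal G (v ∷ ps) w × 2 + W (w ∷ v ∷ ps) ≤ W ps)
  where
  open Game G

  staller-bounded : ∀ k ps → W ps ≤ k → StaForces k ps
  answer : ∀ k ps v → Legal ps v → W ps ≤ suc k → DomForces k (v ∷ ps)
  reply : ∀ k {ps v} → (Σ (Fin m) λ w → Legal (v ∷ ps) w × 2 + W (w ∷ v ∷ ps) ≤ W ps) →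
          W ps ≤ suc k → DomForces k (v ∷ ps)

  staller-bounded zero    ps W≤0 = s-end (exhausted ps (n≤0⇒n≡0 W≤0))
  staller-bounded (suc k) ps W≤k = s-move λ v legal → answer k ps v legal W≤k

  answer k ps v legal W≤k with W (v ∷ ps) ≟ 0
  ... | yes W≡0 = d-end (exhausted (v ∷ ps) W≡0)
  ... | no  W≢0 = reply k (round ps v legal W≢0) W≤k

  -- a drop by 2 is impossible when only one move remains, so that case is absurd
  reply zero    (w , legal , drop) W≤1 = contradiction (≤-trans drop W≤1) λ { (s≤s ()) }
  reply (suc k) {ps} {v} (w , legal , drop) W≤k =
    d-move w legal (staller-bounded k (w ∷ v ∷ ps) (s≤s⁻¹ (s≤s⁻¹ (≤-trans drop W≤k))))

  opening : ∀ k v → Legal [] v → W (v ∷ []) ≤ k → DomForces (suc k) []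
  opening k v legal W≤k = d-move v legal (staller-bounded k (v ∷ []) W≤k)

cap₂ : ℕ → ℕ
cap₂ 0             = 0
cap₂ 1             = 1
cap₂ (suc (suc _)) = 2

cap₂-mono : ∀ {a b} → a ≤ b → cap₂ a ≤ cap₂ b
cap₂-mono {zero}                        _           = z≤n
cap₂-mono {suc zero}    {suc zero}      _           = s≤s z≤n
cap₂-mono {suc zero}    {suc (suc b)}   _           = s≤s z≤n
cap₂-mono {suc (suc a)} {suc (suc b)}   _           = ≤-refl
cap₂-mono {suc (suc a)} {suc zero}      (s≤s ())

cap₂≤2 : ∀ a → cap₂ a ≤ 2
cap₂≤2 zero          = z≤n
cap₂≤2 (suc zero)    = s≤s z≤n
cap₂≤2 (suc (suc a)) = ≤-refl

cap₂≤id : ∀ a → cap₂ a ≤ a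
cap₂≤id zero          = z≤n
cap₂≤id (suc zero)    = ≤-refl
cap₂≤id (suc (suc a)) = s≤s (s≤s z≤n)

cap₂-positive : ∀ {a} → 1 ≤ a → 1 ≤ cap₂ a
cap₂-positive {suc zero}    _ = s≤s z≤n
cap₂-positive {suc (suc a)} _ = s≤s z≤n

cap₂-zero : ∀ {a} → cap₂ a ≡ 0 → a ≡ 0
cap₂-zero {zero}        _ = refl
cap₂-zero {suc zero}    ()
cap₂-zero {suc (suc a)} ()

cap₂-reflects-< : ∀ {a b} → cap₂ a < cap₂ b → a < b
cap₂-reflects-< {a} {b} lt with a <? b
... | yes a<b = a<b
... | no  a≮b = contradiction lt (≤⇒≯ (cap₂-mono (≮⇒≥ a≮b)))

cap₂-saturated : ∀ {a b} → a < b → ¬ cap₂ a < cap₂ b → 2 ≤ a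
cap₂-saturated {zero}        {suc b}       _        stuck = contradiction (cap₂-positive {suc b} (s≤s z≤n)) stuck
cap₂-saturated {suc zero}    {suc zero}    (s≤s ()) _
cap₂-saturated {suc zero}    {suc (suc b)} _        stuck = contradiction ≤-refl stuck
cap₂-saturated {suc (suc a)}               _        _     = s≤s (s≤s z≤n)

cap₂-full : ∀ {a} → 2 ≤ a → cap₂ a ≡ 2
cap₂-full {suc (suc a)} _        = refl
cap₂-full {suc zero}    (s≤s ())

module Counting {Dom : ℕ → ℕ → Set} (Dom? : ∀ x y → Dec (Dom x y)) where

  DominatedBy : List ℕ → ℕ → Set
  DominatedBy xs y = Any (λ x → Dom x y) xs

  dominatedBy? : ∀ xs y → Dec (DominatedBy xs y)
  dominatedBy? xs y = any? (λ x → Dom? x y) xs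

  undominated : List ℕ → List ℕ → ℕ
  undominated []      xs = 0
  undominated (y ∷ B) xs with dominatedBy? xs y
  ... | yes _ = undominated B xs
  ... | no  _ = suc (undominated B xs)

  undominated-antitone : ∀ {xs ys} → (∀ {y} → DominatedBy xs y → DominatedBy ys y) →
                         ∀ B → undominated B ys ≤ undominated B xs
  undominated-antitone ext []      = z≤n
  undominated-antitone {xs} {ys} ext (y ∷ B) with dominatedBy? xs y | dominatedBy? ys y
  ... | yes _  | yes _  = undominated-antitone ext B
  ... | yes dx | no ¬dy = contradiction (ext dx) ¬dy
  ... | no  _  | yes _  = m≤n⇒m≤1+n (undominated-antitone ext B)
  ... | no  _  | no  _  = s≤s (undominated-antitone ext B)

  undominated-cons : ∀ x xs B → undominated B (x ∷ xs) ≤ undominated B xs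
  undominated-cons x xs = undominated-antitone there

  undominated-drop : ∀ {x xs y} B → y ∈ B → ¬ DominatedBy xs y → Dom x y →
                     undominated B (x ∷ xs) < undominated B xs
  undominated-drop {x} {xs} (y ∷ B) (here refl) ¬dy dxy with dominatedBy? xs y | dominatedBy? (x ∷ xs) y
  ... | yes dy | _      = contradiction dy ¬dy
  ... | no  _  | yes _  = s≤s (undominated-cons x xs B)
  ... | no  _  | no ¬d  = contradiction (here dxy) ¬d
  undominated-drop {x} {xs} (z ∷ B) (there y∈B) ¬dy dxy with dominatedBy? xs z | dominatedBy? (x ∷ xs) z
  ... | yes _  | yes _  = undominated-drop B y∈B ¬dy dxy
  ... | yes dz | no ¬d  = contradiction (there dz) ¬d
  ... | no  _  | yes _  = m≤n⇒m≤1+n (undominated-drop B y∈B ¬dy dxy)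
  ... | no  _  | no  _  = s≤s (undominated-drop B y∈B ¬dy dxy)

  newly-dominated : ∀ x xs B → undominated B (x ∷ xs) < undominated B xs →
                    Σ ℕ λ y → y ∈ B × ¬ DominatedBy xs y × Dom x y
  newly-dominated x xs (z ∷ B) lt with dominatedBy? xs z | dominatedBy? (x ∷ xs) z
  ... | yes dz | no ¬d          = contradiction (there dz) ¬d
  ... | no ¬dz | yes (here dxz) = z , here refl , ¬dz , dxz
  ... | no ¬dz | yes (there dz) = contradiction dz ¬dz
  ... | yes _  | yes _ with newly-dominated x xs B lt
  ...   | y , y∈B , ¬dy , dxy = y , there y∈B , ¬dy , dxy
  newly-dominated x xs (z ∷ B) lt | no _ | no _ with newly-dominated x xs B (s≤s⁻¹ lt)
  ...   | y , y∈B , ¬dy , dxy = y , there y∈B , ¬dy , dxy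

  undominated-zero : ∀ {xs y} B → undominated B xs ≡ 0 → y ∈ B → DominatedBy xs y
  undominated-zero {xs} (z ∷ B) eq y∈B with dominatedBy? xs z
  undominated-zero (z ∷ B) eq (here refl)  | yes dz = dz
  undominated-zero (z ∷ B) eq (there y∈B) | yes _  = undominated-zero B eq y∈B

  undominated-none : ∀ {xs} B → (∀ {y} → y ∈ B → DominatedBy xs y) → undominated B xs ≡ 0
  undominated-none []           all = refl
  undominated-none {xs} (y ∷ B) all with dominatedBy? xs y
  ... | yes _ = undominated-none B (λ y∈B → all (there y∈B))
  ... | no ¬d = contradiction (all (here refl)) ¬d

  undominated-fresh : ∀ {xs} B → (∀ {y} → y ∈ B → ¬ DominatedBy xs y) → undominated B xs ≡ length B
  undominated-fresh []           fresh = refl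
  undominated-fresh {xs} (y ∷ B) fresh with dominatedBy? xs y
  ... | yes d = contradiction d (fresh (here refl))
  ... | no  _ = cong suc (undominated-fresh B (λ y∈B → fresh (there y∈B)))

  undominated-head : ∀ {xs} u rest → (∀ {y} → y ∈ rest → DominatedBy xs y) → undominated (u ∷ rest) xs ≤ 1
  undominated-head {xs} u rest all with dominatedBy? xs u
  ... | yes _ = ≤-trans (≤-reflexive (undominated-none rest all)) z≤n
  ... | no  _ = s≤s (≤-reflexive (undominated-none rest all))

  module Blocks (M : ℕ) where

    record Move (xs : List ℕ) : Set where
      field
        vertex   : ℕ
        vertex<  : vertex < M
        target   : ℕ
        target<  : target < M
        covers   : Dom vertex target
        fresh    : ¬ DominatedBy xs target

    open Move public

    -- a block: once touched it can be finished by one move, and untouched it can be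
    -- reduced (in weight) by one move
    record Block : Set where
      field
        vertices  : List ℕ
        bounded   : All (_< M) vertices
        finish    : ∀ xs → Any (DominatedBy xs) vertices →
                    Σ ℕ λ f → f < M × (∀ {y} → y ∈ vertices → DominatedBy xs y ⊎ Dom f y)
        reducer   : ℕ
        reducer<  : reducer < M
        reduces   : cap₂ (undominated vertices (reducer ∷ [])) < cap₂ (length vertices)

    open Block public

    weight : Block → List ℕ → ℕ
    weight B xs = cap₂ (undominated (vertices B) xs)

    weight-antitone : ∀ {xs ys} → (∀ {y} → DominatedBy xs y → DominatedBy ys y) →
                      ∀ B → weight B ys ≤ weight B xs
    weight-antitone ext B = cap₂-mono (undominated-antitone ext (vertices B))

    weight-≤-size : ∀ B xs → weight B xs ≤ length (vertices B)
    weight-≤-size B xs = begin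
      weight B xs                 ≤⟨ cap₂≤id _ ⟩
      undominated (vertices B) xs ≤⟨ undominated-antitone (λ ()) (vertices B) ⟩
      undominated (vertices B) [] ≡⟨ undominated-fresh (vertices B) (λ _ ()) ⟩
      length (vertices B)         ∎
      where open ≤-Reasoning

    progress-move : ∀ B xs w → w < M → undominated (vertices B) (w ∷ xs) < undominated (vertices B) xs → Move xs
    progress-move B xs w w<M lt with newly-dominated w xs (vertices B) lt
    ... | y , y∈B , ¬dy , dwy = record
      { vertex = w ; vertex< = w<M ; target = y ; target< = All.lookup (bounded B) y∈B
      ; covers = dwy ; fresh = ¬dy }

    finishing-move : ∀ B xs → Any (DominatedBy xs) (vertices B) → 1 ≤ undominated (vertices B) xs →
                     Σ (Move xs) λ mv → weight B (vertex mv ∷ xs) ≡ 0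
    finishing-move B xs started pending with finish B xs started
    ... | f , f<M , completes = progress-move B xs f f<M (subst (_< _) (sym finished) pending)
                              , cong cap₂ finished
      where
      finished : undominated (vertices B) (f ∷ xs) ≡ 0
      finished = undominated-none (vertices B) λ y∈B → [ there , here ]′ (completes y∈B)

    reducing-move : ∀ B xs → 1 ≤ weight B xs → Σ (Move xs) λ mv → weight B (vertex mv ∷ xs) < weight B xs
    reducing-move B xs positive with any? (dominatedBy? xs) (vertices B)
    ... | yes started with finishing-move B xs started (≤-trans positive (cap₂≤id _))
    ...   | mv , done = mv , subst (_< weight B xs) (sym done) positive
    reducing-move B xs positive | no untouched =
      progress-move B xs (reducer B) (reducer< B) (cap₂-reflects-< lt) , lt
      where
      all-fresh : ∀ {y} → y ∈ vertices B → ¬ DominatedBy xs y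
      all-fresh y∈B dy = untouched (Any.map (λ { refl → dy }) y∈B)
      lt : weight B (reducer B ∷ xs) < weight B xs
      lt = begin-strict
        weight B (reducer B ∷ xs)                        ≤⟨ cap₂-mono (undominated-antitone (λ { (here d) → here d }) (vertices B)) ⟩
        cap₂ (undominated (vertices B) (reducer B ∷ [])) <⟨ reduces B ⟩
        cap₂ (length (vertices B))                       ≡⟨ cong cap₂ (undominated-fresh (vertices B) all-fresh) ⟨
        weight B xs                                      ∎
        where open ≤-Reasoning

    Potential : List Block → List ℕ → ℕ
    Potential bs xs = sum (map (λ B → weight B xs) bs)

    potential-antitone : ∀ {xs ys} → (∀ {y} → DominatedBy xs y → DominatedBy ys y) →
                         ∀ bs → Potential bs ys ≤ Potential bs xs
    potential-antitone ext []       = z≤n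
    potential-antitone ext (B ∷ bs) = +-mono-≤ (weight-antitone ext B) (potential-antitone ext bs)

    potential-drop : ∀ {xs ys B} d bs → (∀ {y} → DominatedBy xs y → DominatedBy ys y) →
                     B ∈ bs → d + weight B ys ≤ weight B xs → d + Potential bs ys ≤ Potential bs xs
    potential-drop {xs} {ys} d (B ∷ bs) ext (here refl) drop = begin
      d + (weight B ys + Potential bs ys) ≡⟨ +-assoc d _ _ ⟨
      d + weight B ys + Potential bs ys   ≤⟨ +-mono-≤ drop (potential-antitone ext bs) ⟩
      weight B xs + Potential bs xs       ∎
      where open ≤-Reasoning
    potential-drop {xs} {ys} d (C ∷ bs) ext (there B∈bs) drop = begin
      d + (weight C ys + Potential bs ys) ≡⟨ x∙yz≈y∙xz d (weight C ys) (Potential bs ys) ⟩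
      weight C ys + (d + Potential bs ys) ≤⟨ +-mono-≤ (weight-antitone ext C) (potential-drop d bs ext B∈bs drop) ⟩
      weight C xs + Potential bs xs       ∎
      where open ≤-Reasoning

    potential-zero : ∀ {xs B} bs → Potential bs xs ≡ 0 → B ∈ bs → weight B xs ≡ 0
    potential-zero {xs} (B ∷ bs) eq (here refl)  = m+n≡0⇒m≡0 (weight B xs) eq
    potential-zero {xs} (C ∷ bs) eq (there B∈bs) = potential-zero bs (m+n≡0⇒n≡0 (weight C xs) eq) B∈bs

    potential-positive : ∀ {xs} bs → Potential bs xs ≢ 0 → Σ Block λ B → B ∈ bs × 1 ≤ weight B xs
    potential-positive []            P≢0 = contradiction refl P≢0
    potential-positive {xs} (B ∷ bs) P≢0 with weight B xs ≟ 0
    ... | no  w≢0 = B , here refl , n≢0⇒n>0 w≢0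
    ... | yes w≡0 with potential-positive bs (λ P≡0 → P≢0 (cong₂ _+_ w≡0 P≡0))
    ...   | C , C∈bs , positive = C , there C∈bs , positive

    potential-≤ : ∀ xs bs → Potential bs xs ≤ 2 * length bs
    potential-≤ xs []       = z≤n
    potential-≤ xs (B ∷ bs) = subst (Potential (B ∷ bs) xs ≤_) (sym (*-suc 2 (length bs)))
                                (+-mono-≤ (cap₂≤2 _) (potential-≤ xs bs))

    dominator-step : ∀ {xs} bs → Potential bs xs ≢ 0 → Σ (Move xs) λ mv → 1 + Potential bs (vertex mv ∷ xs) ≤ Potential bs xs
    dominator-step {xs} bs P≢0 with potential-positive bs P≢0
    ... | B , B∈bs , positive with reducing-move B xs positive
    ...   | mv , lt = mv , potential-drop 1 bs there B∈bs lt

    stalled-block : ∀ {xs x u} B → u ∈ vertices B → ¬ DominatedBy xs u → Dom x u →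
                    ¬ weight B (x ∷ xs) < weight B xs →
                    2 ≤ undominated (vertices B) (x ∷ xs) × weight B xs ≡ 2
    stalled-block {xs} {x} B u∈B ¬du dxu stalled = saturated , cap₂-full (≤-trans saturated (<⇒≤ count-drop))
      where
      count-drop : undominated (vertices B) (x ∷ xs) < undominated (vertices B) xs
      count-drop = undominated-drop (vertices B) u∈B ¬du dxu
      saturated : 2 ≤ undominated (vertices B) (x ∷ xs)
      saturated = cap₂-saturated count-drop stalled

    round : ∀ {xs x u B} bs → B ∈ bs → u ∈ vertices B → ¬ DominatedBy xs u → Dom x u →
            Potential bs (x ∷ xs) ≢ 0 →
            Σ (Move (x ∷ xs)) λ mv → 2 + Potential bs (vertex mv ∷ x ∷ xs) ≤ Potential bs xs
    round {xs} {x} {u} {B} bs B∈bs u∈B ¬du dxu P≢0 with weight B (x ∷ xs) <? weight B xs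
    ... | yes staller-lowered with dominator-step bs P≢0
    ...   | mv , dominator-lowered =
      mv , ≤-trans (s≤s dominator-lowered) (potential-drop 1 bs there B∈bs staller-lowered)
    round {xs} {x} {u} {B} bs B∈bs u∈B ¬du dxu P≢0 | no stalled
      with stalled-block B u∈B ¬du dxu stalled
    ... | pending , full
      with finishing-move B (x ∷ xs) (Any.map (λ { refl → here dxu }) u∈B) (≤-trans (s≤s z≤n) pending)
    ... | mv , finished = mv , potential-drop 2 bs (λ d → there (there d)) B∈bs
                                 (subst₂ (λ a b → 2 + a ≤ b) (sym finished) (sym full) ≤-refl)

    star : (vs : List ℕ) (c : ℕ) → All (_< M) vs → c < M → (∀ {y} → y ∈ vs → Dom c y) → 1 ≤ length vs → Block
    star vs c vs<M c<M covers nonempty = record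
      { vertices = vs ; bounded = vs<M
      ; finish   = λ xs _ → c , c<M , λ y∈vs → inj₂ (covers y∈vs)
      ; reducer  = c ; reducer< = c<M
      ; reduces  = subst (λ k → cap₂ k < cap₂ (length vs))
                         (sym (undominated-none vs λ y∈vs → here (covers y∈vs)))
                         (cap₂-positive nonempty) }

    -- A block u ∷ rest with two exits u and t: whoever dominates a vertex of rest also
    -- dominates u or t.  If u is dominated, fᵤ (which dominates rest) finishes the block;
    -- otherwise the block was entered through t, and fₜ dominates everything except t.
    corridor : (u : ℕ) (rest : List ℕ) (t fᵤ fₜ : ℕ) →
               All (_< M) (u ∷ rest) → fᵤ < M → fₜ < M →
               (∀ {y} → y ∈ rest → Dom fᵤ y) →
               (∀ {y} → y ∈ u ∷ rest → y ≡ t ⊎ Dom fₜ y) →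
               (∀ {y x} → y ∈ rest → Dom x y → Dom x u ⊎ Dom x t) →
               1 ≤ length rest → Block
    corridor u rest t fᵤ fₜ vs<M fᵤ<M fₜ<M fᵤ-covers fₜ-covers exits nonempty = record
      { vertices = u ∷ rest ; bounded = vs<M ; finish = finish′
      ; reducer  = fᵤ ; reducer< = fᵤ<M
      ; reduces  = ≤-trans (s≤s (cap₂-mono (undominated-head u rest λ y∈rest → here (fᵤ-covers y∈rest))))
                           (cap₂-mono {2} {suc (length rest)} (s≤s nonempty)) }
      where
      through-t : ∀ {xs} → Any (DominatedBy xs) rest → ¬ DominatedBy xs u → DominatedBy xs t
      through-t entered ¬du with find entered
      ... | y , y∈rest , dy = [ (λ du → contradiction du ¬du) , (λ dt → dt) ]′ (Any-⊎⁻ (Any.map (exits y∈rest) dy))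

      finish′ : ∀ xs → Any (DominatedBy xs) (u ∷ rest) →
                Σ ℕ λ f → f < M × (∀ {y} → y ∈ u ∷ rest → DominatedBy xs y ⊎ Dom f y)
      finish′ xs started with dominatedBy? xs u
      ... | yes du = fᵤ , fᵤ<M , λ { (here refl) → inj₁ du ; (there y∈rest) → inj₂ (fᵤ-covers y∈rest) }
      ... | no ¬du = fₜ , fₜ<M , λ y∈vs → [ (λ { refl → inj₁ dt }) , inj₂ ]′ (fₜ-covers y∈vs)
        where
        entered : Any (DominatedBy xs) (u ∷ rest) → Any (DominatedBy xs) rest
        entered (here du)     = contradiction du ¬du
        entered (there inner) = inner
        dt : DominatedBy xs t
        dt = through-t (entered started) ¬du

RDom : ℕ → ℕ → Set
RDom x y = (y ≡ x) ⊎ (REdge x y ⊎ REdge y x)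

REdge? : ∀ a b → Dec (REdge a b)
REdge? a b = (suc a ≟ b) ⊎-dec (((a ≟ 0) ×-dec (b ≟ 4)) ⊎-dec (((a ≟ 5) ×-dec (b ≟ 8)) ⊎-dec ((a ≟ 1) ×-dec (b ≟ 7))))

RDom? : ∀ x y → Dec (RDom x y)
RDom? x y = (y ≟ x) ⊎-dec (REdge? x y ⊎-dec REdge? y x)

open Counting RDom?

dom-self : ∀ x → RDom x x
dom-self x = inj₁ refl

dom-next : ∀ x → RDom x (suc x)
dom-next x = inj₂ (inj₁ (inj₁ refl))

dom-prev : ∀ x → RDom (suc x) x
dom-prev x = inj₂ (inj₂ (inj₁ refl))

far-dominators : ∀ k {x} → RDom x (9 + k) → x ≡ 8 + k ⊎ x ≡ 9 + k ⊎ x ≡ 10 + k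
far-dominators k (inj₁ refl)                                 = inj₂ (inj₁ refl)
far-dominators k (inj₂ (inj₁ (inj₁ refl)))                   = inj₁ refl
far-dominators k (inj₂ (inj₁ (inj₂ (inj₁ (_ , ())))))
far-dominators k (inj₂ (inj₁ (inj₂ (inj₂ (inj₁ (_ , ()))))))
far-dominators k (inj₂ (inj₁ (inj₂ (inj₂ (inj₂ (_ , ()))))))
far-dominators k (inj₂ (inj₂ (inj₁ refl)))                   = inj₂ (inj₂ refl)
far-dominators k (inj₂ (inj₂ (inj₂ (inj₁ (() , _)))))
far-dominators k (inj₂ (inj₂ (inj₂ (inj₂ (inj₁ (() , _))))))
far-dominators k (inj₂ (inj₂ (inj₂ (inj₂ (inj₂ (() , _))))))

dominators-of-8 : ∀ {x} → RDom x 8 → x ≡ 5 ⊎ x ≡ 7 ⊎ x ≡ 8 ⊎ x ≡ 9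
dominators-of-8 (inj₁ refl)                                   = inj₂ (inj₂ (inj₁ refl))
dominators-of-8 (inj₂ (inj₁ (inj₁ refl)))                     = inj₂ (inj₁ refl)
dominators-of-8 (inj₂ (inj₁ (inj₂ (inj₂ (inj₁ (refl , _)))))) = inj₁ refl
dominators-of-8 (inj₂ (inj₂ (inj₁ refl)))                     = inj₂ (inj₂ (inj₂ refl))
dominators-of-8 (inj₂ (inj₁ (inj₂ (inj₁ (_ , ())))))
dominators-of-8 (inj₂ (inj₁ (inj₂ (inj₂ (inj₂ (_ , ()))))))
dominators-of-8 (inj₂ (inj₂ (inj₂ (inj₁ (() , _)))))
dominators-of-8 (inj₂ (inj₂ (inj₂ (inj₂ (inj₁ (() , _))))))
dominators-of-8 (inj₂ (inj₂ (inj₂ (inj₂ (inj₂ (() , _))))))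

module RBlocks (p : ℕ) where

  M : ℕ
  M = 11 + 4 * p

  open Blocks M public

  small< : ∀ k {k≤10 : True (k ≤? 10)} → k < M
  small< k {k≤10} = ≤-trans (s≤s (toWitness k≤10)) (m≤m+n 11 (4 * p))

  left : Block
  left = star (0 ∷ 1 ∷ 2 ∷ 7 ∷ []) 1 (small< 0 ∷ small< 1 ∷ small< 2 ∷ small< 7 ∷ []) (small< 1)
              (λ { (here refl) → dom-prev 0 ; (there (here refl)) → dom-self 1
                 ; (there (there (here refl))) → dom-next 1
                 ; (there (there (there (here refl)))) → inj₂ (inj₁ (inj₂ (inj₂ (inj₂ (refl , refl))))) })
              (s≤s z≤n)

  middle : Block
  middle = star (3 ∷ 4 ∷ 5 ∷ []) 4 (small< 3 ∷ small< 4 ∷ small< 5 ∷ []) (small< 4)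
                (λ { (here refl) → dom-prev 3 ; (there (here refl)) → dom-self 4
                   ; (there (there (here refl))) → dom-next 4 })
                (s≤s z≤n)

  -- {6,8,9}: exits 6 and 9; 8 finishes once 6 is dominated, 7 once 9 is
  knot : Block
  knot = corridor 6 (8 ∷ 9 ∷ []) 9 8 7 (small< 6 ∷ small< 8 ∷ small< 9 ∷ []) (small< 8) (small< 7)
                  (λ { (here refl) → dom-self 8 ; (there (here refl)) → dom-next 8 })
                  (λ { (here refl) → inj₂ (dom-prev 6) ; (there (here refl)) → inj₂ (dom-next 7)
                     ; (there (there (here refl))) → inj₁ refl })
                  exits
                  (s≤s z≤n)
    where
    exits : ∀ {y x} → y ∈ 8 ∷ 9 ∷ [] → RDom x y → RDom x 6 ⊎ RDom x 9
    exits (here refl) d with dominators-of-8 d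
    ... | inj₁ refl               = inj₁ (dom-next 5)
    ... | inj₂ (inj₁ refl)        = inj₁ (dom-prev 6)
    ... | inj₂ (inj₂ (inj₁ refl)) = inj₂ (dom-next 8)
    ... | inj₂ (inj₂ (inj₂ refl)) = inj₂ (dom-self 9)
    exits (there (here refl)) d = inj₂ d

  tail : Fin p → Block
  tail i = corridor (10 + a) (11 + a ∷ 12 + a ∷ 13 + a ∷ []) (13 + a) (12 + a) (11 + a)
                    (bound 0 ∷ bound 1 ∷ bound 2 ∷ bound 3 ∷ []) (bound 2) (bound 1)
                    (λ { (here refl) → dom-prev (11 + a) ; (there (here refl)) → dom-self (12 + a)
                       ; (there (there (here refl))) → dom-next (12 + a) })
                    (λ { (here refl) → inj₂ (dom-prev (10 + a)) ; (there (here refl)) → inj₂ (dom-self (11 + a))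
                       ; (there (there (here refl))) → inj₂ (dom-next (11 + a))
                       ; (there (there (there (here refl)))) → inj₁ refl })
                    exits
                    (s≤s z≤n)
    where
    a : ℕ
    a = 4 * toℕ i
    last< : 13 + a < M
    last< = begin-strict
      13 + a               <⟨ ≤-refl ⟩
      10 + (4 + 4 * toℕ i) ≡⟨ cong (10 +_) (*-suc 4 (toℕ i)) ⟨
      10 + 4 * suc (toℕ i) ≤⟨ +-monoʳ-≤ 10 (*-monoʳ-≤ 4 (toℕ<n i)) ⟩
      10 + 4 * p           <⟨ ≤-refl ⟩
      M                    ∎
      where open ≤-Reasoning
    bound : ∀ k {k≤3 : True (k ≤? 3)} → k + (10 + a) < M
    bound k {k≤3} = ≤-trans (s≤s (+-monoˡ-≤ (10 + a) (toWitness k≤3))) last<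
    exits : ∀ {y x} → y ∈ 11 + a ∷ 12 + a ∷ 13 + a ∷ [] → RDom x y → RDom x (10 + a) ⊎ RDom x (13 + a)
    exits (here refl) d with far-dominators (2 + a) d
    ... | inj₁ refl        = inj₁ (dom-self (10 + a))
    ... | inj₂ (inj₁ refl) = inj₁ (dom-prev (10 + a))
    ... | inj₂ (inj₂ refl) = inj₂ (dom-next (12 + a))
    exits (there (here refl)) d with far-dominators (3 + a) d
    ... | inj₁ refl        = inj₁ (dom-prev (10 + a))
    ... | inj₂ (inj₁ refl) = inj₂ (dom-next (12 + a))
    ... | inj₂ (inj₂ refl) = inj₂ (dom-self (13 + a))
    exits (there (there (here refl))) d = inj₂ d

  end : Block
  end = star (10 + 4 * p ∷ []) (10 + 4 * p) (≤-refl ∷ []) ≤-refl (λ { (here refl) → dom-self (10 + 4 * p) }) (s≤s z≤n)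

  blocks : List Block
  blocks = left ∷ middle ∷ knot ∷ end ∷ tabulate tail

  tail-in-blocks : ∀ i → tail i ∈ blocks
  tail-in-blocks i = there (there (there (there (∈-tabulate⁺ i))))

  in-tail : ∀ i r → r < 4 → 10 + (r + 4 * toℕ i) ∈ vertices (tail i)
  in-tail i 0 _ = here refl
  in-tail i 1 _ = there (here refl)
  in-tail i 2 _ = there (there (here refl))
  in-tail i 3 _ = there (there (there (here refl)))
  in-tail i (suc (suc (suc (suc r)))) (s≤s (s≤s (s≤s (s≤s ()))))

  -- vertex 10 + t lies in tail block ⌊t/4⌋ when t < 4p, and is the end vertex otherwise
  -- (the decision is passed as an argument: a 'with' here would abstract over blocks)
  beyond-knot : ∀ t → 10 + t < M → Dec (t < 4 * p) → Σ Block λ B → B ∈ blocks × 10 + t ∈ vertices B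
  beyond-knot t _ (yes t<4p) = tail i , tail-in-blocks i
                             , subst (λ s → 10 + s ∈ vertices (tail i)) (sym t≡) (in-tail i (t % 4) (m%n<n t 4))
    where
    q<p : t / 4 < p
    q<p = m<n*o⇒m/o<n (subst (t <_) (*-comm 4 p) t<4p)
    i : Fin p
    i = fromℕ< q<p
    t≡ : t ≡ t % 4 + 4 * toℕ i
    t≡ = begin
      t                   ≡⟨ m≡m%n+[m/n]*n t 4 ⟩
      t % 4 + t / 4 * 4   ≡⟨ cong (t % 4 +_) (*-comm (t / 4) 4) ⟩
      t % 4 + 4 * (t / 4) ≡⟨ cong (λ q → t % 4 + 4 * q) (toℕ-fromℕ< q<p) ⟨
      t % 4 + 4 * toℕ i   ∎
      where open ≡-Reasoning
  beyond-knot t 10+t<M (no t≮4p) = end , there (there (there (here refl))) , here (cong (10 +_) t≡4p)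
    where
    t≡4p : t ≡ 4 * p
    t≡4p = ≤-antisym (+-cancelˡ-≤ 10 t (4 * p) (s≤s⁻¹ 10+t<M)) (≮⇒≥ t≮4p)

  cover : ∀ y → y < M → Σ Block λ B → B ∈ blocks × y ∈ vertices B
  cover 0 _ = left , here refl , here refl
  cover 1 _ = left , here refl , there (here refl)
  cover 2 _ = left , here refl , there (there (here refl))
  cover 3 _ = middle , there (here refl) , here refl
  cover 4 _ = middle , there (here refl) , there (here refl)
  cover 5 _ = middle , there (here refl) , there (there (here refl))
  cover 6 _ = knot , there (there (here refl)) , here refl
  cover 7 _ = left , here refl , there (there (there (here refl)))
  cover 8 _ = knot , there (there (here refl)) , there (here refl)
  cover 9 _ = knot , there (there (here refl)) , there (there (here refl))
  cover (suc (suc (suc (suc (suc (suc (suc (suc (suc (suc t)))))))))) y<M = beyond-knot t y<M (t <? 4 * p)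

  -- after the opening move 1: left has weight 0, middle and knot 2 (by evaluation),
  -- end at most 1 and each of the p tail blocks at most 2
  initial-potential : Potential blocks (1 ∷ []) ≤ 5 + 2 * p
  initial-potential = +-monoʳ-≤ 4 (+-mono-≤ (weight-≤-size end (1 ∷ []))
                        (subst (Potential (tabulate tail) (1 ∷ []) ≤_) (cong (2 *_) (length-tabulate tail))
                               (potential-≤ (1 ∷ []) (tabulate tail))))

module RGame (p : ℕ) where
  open RBlocks p public

  n : ℕ
  n = 2 + p

  open Game (R n) public

  vertex-count : 4 * n + 3 ≡ M
  vertex-count = begin
    4 * (2 + p) + 3 ≡⟨ cong (_+ 3) (*-distribˡ-+ 4 2 p) ⟩
    8 + 4 * p + 3   ≡⟨ +-comm (8 + 4 * p) 3 ⟩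
    M               ∎
    where open ≡-Reasoning

  toFin : ∀ {y} → y < M → Fin (4 * n + 3)
  toFin {y} y<M = fromℕ< (subst (y <_) (sym vertex-count) y<M)

  toℕ-toFin : ∀ {y} (y<M : y < M) → toℕ (toFin y<M) ≡ y
  toℕ-toFin {y} y<M = toℕ-fromℕ< (subst (y <_) (sym vertex-count) y<M)

  labels : List (Fin (4 * n + 3)) → List ℕ
  labels = map toℕ

  W : List (Fin (4 * n + 3)) → ℕ
  W ps = Potential blocks (labels ps)

  dominates⇒ : ∀ {v u} → Dominates v u → RDom (toℕ v) (toℕ u)
  dominates⇒ (inj₁ refl) = inj₁ refl
  dominates⇒ (inj₂ adj)  = inj₂ adj

  dominates⇐ : ∀ {v u} → RDom (toℕ v) (toℕ u) → Dominates v u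
  dominates⇐ (inj₁ eq)  = inj₁ (toℕ-injective eq)
  dominates⇐ (inj₂ adj) = inj₂ adj

  dominated⇒ : ∀ ps u → Dominated ps u → DominatedBy (labels ps) (toℕ u)
  dominated⇒ ps u d = map⁺ (Any.map dominates⇒ d)

  dominated⇐ : ∀ ps u → DominatedBy (labels ps) (toℕ u) → Dominated ps u
  dominated⇐ ps u d = Any.map dominates⇐ (map⁻ d)

  cover-vertex : ∀ u → Σ Block λ B → B ∈ blocks × toℕ u ∈ vertices B
  cover-vertex u = cover (toℕ u) (subst (toℕ u <_) vertex-count (toℕ<n u))

  legal-move : ∀ ps (mv : Move (labels ps)) → Legal ps (toFin (vertex< mv))
  legal-move ps mv = toFin (target< mv)
                   , dominates⇐ (subst₂ RDom (sym (toℕ-toFin (vertex< mv))) (sym (toℕ-toFin (target< mv))) (covers mv))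
                   , λ d → fresh mv (subst (DominatedBy (labels ps)) (toℕ-toFin (target< mv)) (dominated⇒ ps _ d))

  -- potential 0: every block, hence (by cover) every vertex, is dominated
  exhausted : ∀ ps → W ps ≡ 0 → Ended ps
  exhausted ps W≡0 v (u , _ , ¬du) =
    let B , B∈bs , u∈B = cover-vertex u
    in ¬du (dominated⇐ ps u (undominated-zero (vertices B) (cap₂-zero (potential-zero blocks W≡0 B∈bs)) u∈B))

  game-round : ∀ ps v → Legal ps v → W (v ∷ ps) ≢ 0 →
               Σ (Fin (4 * n + 3)) λ w → Legal (v ∷ ps) w × 2 + W (w ∷ v ∷ ps) ≤ W ps
  game-round ps v (u , dvu , ¬du) W≢0 =
    let B , B∈bs , u∈B = cover-vertex u
        mv , drop      = round blocks B∈bs u∈B (λ d → ¬du (dominated⇐ ps u d)) (dominates⇒ dvu) W≢0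
    in toFin (vertex< mv) , legal-move (v ∷ ps) mv
     , subst (λ w → 2 + Potential blocks (w ∷ toℕ v ∷ labels ps) ≤ W ps) (sym (toℕ-toFin (vertex< mv))) drop

  open PotentialStrategy (R n) W exhausted game-round public

  first : Fin (4 * n + 3)
  first = toFin (small< 1)

  first-legal : Legal [] first
  first-legal = first , inj₁ refl , λ ()

  first-potential : W (first ∷ []) ≤ 2 * n + 1
  first-potential = begin
    Potential blocks (toℕ first ∷ []) ≡⟨ cong (λ y → Potential blocks (y ∷ [])) (toℕ-toFin (small< 1)) ⟩
    Potential blocks (1 ∷ [])         ≤⟨ initial-potential ⟩
    5 + 2 * p                         ≡⟨ +-comm 1 (4 + 2 * p) ⟩
    4 + 2 * p + 1                     ≡⟨ cong (_+ 1) (*-distribˡ-+ 2 2 p) ⟨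
    2 * n + 1                         ∎
    where open ≤-Reasoning

proposition6p4 : (n : ℕ) → 2 ≤ n → GameDomNumberAtMost (R n) (2 * n + 2)
proposition6p4 (suc (suc p)) _ =
  subst (λ k → DomForces k []) (sym (+-suc (2 * n) 1))
        (opening (2 * n + 1) first first-legal first-potential)
  where open RGame p
proposition6p4 (suc zero) (s≤s ())
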